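{- For every nonnegative integer $p\notin\{1,3,5\}$ there is a finite simple connected graph $G$ such that $Mo(G)=p$.
   Context: For a connected graph $G$ and an edge $uv\in E(G)$, let $n_u$ be the number of vertices of $G$ strictly closer (in shortest-path distance) to $u$ than to $v$, and $n_v$ analogously. The Mostar index is $Mo(G)=\sum_{uv\in E(G)}|n_u-n_v|$. -}

module Defs where

open import Data.Nat using (ℕ; zero; suc; _+_; _≤_; _<ᵇ_; ∣_-_∣)
open import Data.Bool using (Bool; true; false; _∧_; _∨_; if_then_else_)
open import Data.Fin using (Fin; toℕ; _≟_)
open import Data.List using (List; []; _∷_; map; filter; length; allFin; concatMap)
open import Data.Bool.ListAction using (any)
open import Data.Nat.ListAction using (sum)
open import Data.Product using (∃)
open import Relation.Nullary.Decidable using (⌊_⌋)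
open import Relation.Binary.PropositionalEquality using (_≡_)

record Graph : Set where
  field
    n     : ℕ
    adj   : Fin n → Fin n → Bool
    sym   : ∀ u v → adj u v ≡ adj v u
    irref : ∀ u → adj u u ≡ false

open Graph public

reach : (G : Graph) → ℕ → Fin (n G) → Fin (n G) → Bool
reach G zero    u v = ⌊ u ≟ v ⌋
reach G (suc k) u v =
  reach G k u v ∨ any (λ w → reach G k u w ∧ adj G w v) (allFin (n G))

Connected : Graph → Set
Connected G = (1 ≤ n G) × (∀ u v → ∃ λ k → reach G k u v ≡ true)
  where open import Data.Product using (_×_)

-- Shortest-path distance: the least k with a walk of length ≤ k from u to v.
-- (Searches k = 0,1,…,n; in a connected graph on n vertices the distance is < n,
--  so the fallback value is never used.)
dist : (G : Graph) → Fin (n G) → Fin (n G) → ℕ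
dist G u v = go 0 (n G)
  where
  go : ℕ → ℕ → ℕ
  go k zero    = k
  go k (suc f) = if reach G k u v then k else go (suc k) f

closer : (G : Graph) → Fin (n G) → Fin (n G) → ℕ
closer G u v = length (filter (λ w → dist G w u Data.Nat.<? dist G w v) (allFin (n G)))
  where import Data.Nat

mostar : Graph → ℕ
mostar G = sum (concatMap (λ u → map (λ v → edgeTerm u v) (allFin (n G))) (allFin (n G)))
  where
  edgeTerm : Fin (n G) → Fin (n G) → ℕ
  edgeTerm u v = if (toℕ u <ᵇ toℕ v) ∧ adj G u v
                 then ∣ closer G u v - closer G v u ∣ else 0

{-# OPTIONS --safe #-}
module Submission where

-- Join a small graph H to a clique K_m, making every clique vertex adjacent to a fixed set N of
-- vertices of H.  The clique vertices are twins, so the distances in the join are those of the cone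
-- over H (the case m = 1) with its apex blown up into the clique.  Hence every count n_u grows by a
-- multiple of m, and as long as the sign of n_s - n_t on the edges of H does not flip, the Mostar index
-- is affine in m:  Mo (H ⊕_N K_(1+m)) = Mo (cone) + m * slope.  Four such families, with
-- (Mo (cone), slope) = (0, 2), (11, 4), (9, 8) and (13, 8), together with one cone of Mostar index 7,
-- attain every value other than 1, 3 and 5.  Everything about the small cones themselves (that dist is
-- a metric on them, the sign condition, the two numbers) is checked by evaluation.

open import Defs
open import Data.Nat using (ℕ)
open import Data.Product using (Σ; _×_)
open import Relation.Nullary using (¬_)
open import Relation.Binary.PropositionalEquality using (_≡_)

open import Data.Bool using (Bool; true; false; T; _∧_; _∨_; not; if_then_else_)
open import Data.Bool.ListAction using (any)
open import Data.Bool.Properties using (T-≡; T-∧; T-∨; ∨-comm; ∧-zeroʳ) renaming (_≟_ to _≟ᵇ_)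
open import Data.Fin using (Fin; zero; suc; toℕ; _≟_; _↑ˡ_; _↑ʳ_; splitAt; join)
open import Data.Fin.Properties
  using (all?; any?; +↔⊎; splitAt-join; splitAt-↑ˡ; splitAt-↑ʳ; toℕ-↑ˡ; toℕ-↑ʳ; toℕ<n)
  renaming (suc-injective to Fin-suc-injective)
open import Data.List using (List; []; _∷_; allFin; map; filter; length; tabulate; concatMap)
open import Data.List.Membership.Propositional using (lose)
open import Data.List.Membership.Propositional.Properties using (∈-allFin)
open import Data.List.Properties using (map-tabulate)
open import Data.List.Relation.Unary.Any using (satisfied)
open import Data.List.Relation.Unary.Any.Properties using (any⁺; any⁻)
open import Data.Nat
  using (zero; suc; _+_; _*_; _∸_; _≤_; _<_; _≤?_; _<?_; _<ᵇ_; _≡ᵇ_; ∣_-_∣; z≤n; s≤s)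
  renaming (_≟_ to _≟ℕ_)
import Data.Nat.ListAction as List
open import Data.Nat.ListAction.Properties using (sum-++)
open import Data.Nat.Properties
  using ( +-*-semiring; +-assoc; +-comm; +-identityʳ; *-identityʳ; *-zeroʳ; suc-injective
        ; ≤-refl; ≤-reflexive; ≤-trans; ≤-antisym; <-≤-trans; <⇒≤; ≤⇒≯; <-cmp; n≤1+n; m≤n⇒m≤1+n
        ; n≤0⇒n≡0; m≤n⇒m<n∨m≡n; m≤m+n; +-mono-≤; +-∸-comm; m≤n⇒∣n-m∣≡n∸m; ∣n-n∣≡0; ∣-∣-comm)
open import Algebra.Properties.Semiring.Sum +-*-semiring using (sum-syntax; sum-cong-≗; ∑-distrib-+; *-distribˡ-sum)
open import Data.Nat.Tactic.RingSolver using (solve-∀)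
open import Data.Product using (_,_; ∃-syntax)
open import Data.Sum using (_⊎_; inj₁; inj₂)
open import Data.Sum.Properties using (inj₁-injective)
open import Function using (_∘_; id; _on_; _↔_; _⇔_; Inverse; Equivalence; mk⇔)
open import Function.Properties.Inverse using (↔-sym)
open import Relation.Binary using (tri<; tri≈; tri>)
open import Relation.Binary.PropositionalEquality as ≡
  using (refl; trans; cong; cong₂; subst; subst₂; _≢_; module ≡-Reasoning)
open import Relation.Nullary
  using (Dec; does; proof; yes; no; contradiction; map′; _×-dec_; _⊎-dec_; _→-dec_)
open import Relation.Nullary.Decidable using (toWitness; fromWitness; dec-true; dec-false; from-yes)
open import Relation.Nullary.Reflects using (fromEquivalence; det)

indicator : Bool → ℕ
indicator b = if b then 1 else 0

⟦_<_⟧ : ℕ → ℕ → ℕ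
⟦ a < b ⟧ = indicator (does (a <? b))

⟦<⟧-yes : ∀ {a b} → a < b → ⟦ a < b ⟧ ≡ 1
⟦<⟧-yes {a} {b} a<b = cong indicator (dec-true (a <? b) a<b)

⟦<⟧-no : ∀ {a b} → b ≤ a → ⟦ a < b ⟧ ≡ 0
⟦<⟧-no {a} {b} b≤a = cong indicator (dec-false (a <? b) (≤⇒≯ b≤a))

-- Finite sums

sum-tabulate : ∀ {n} (f : Fin n → ℕ) → List.sum (tabulate f) ≡ ∑[ i < n ] f i
sum-tabulate {zero}  f = refl
sum-tabulate {suc n} f = cong (f zero +_) (sum-tabulate (f ∘ suc))

sum-map-allFin : ∀ {n} (f : Fin n → ℕ) → List.sum (map f (allFin n)) ≡ ∑[ i < n ] f i
sum-map-allFin f = trans (cong List.sum (map-tabulate id f)) (sum-tabulate f)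

sum-concatMap : ∀ {A : Set} (f : A → List ℕ) (xs : List A) →
  List.sum (concatMap f xs) ≡ List.sum (map (List.sum ∘ f) xs)
sum-concatMap f []       = refl
sum-concatMap f (x ∷ xs) = trans (sum-++ (f x) (concatMap f xs)) (cong (List.sum (f x) +_) (sum-concatMap f xs))

length-filter≡sum : ∀ {A : Set} {P : A → Set} (P? : ∀ x → Dec (P x)) (xs : List A) →
  length (filter P? xs) ≡ List.sum (map (indicator ∘ does ∘ P?) xs)
length-filter≡sum P? []       = refl
length-filter≡sum P? (x ∷ xs) with does (P? x)
... | true  = cong suc (length-filter≡sum P? xs)
... | false = length-filter≡sum P? xs

∑-↑ : ∀ k m (f : Fin (k + m) → ℕ) → ∑[ u < k + m ] f u ≡ ∑[ s < k ] f (s ↑ˡ m) + ∑[ i < m ] f (k ↑ʳ i)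
∑-↑ zero    m f = refl
∑-↑ (suc k) m f = trans (cong (f zero +_) (∑-↑ k m (f ∘ suc))) (≡.sym (+-assoc (f zero) _ _))

∑-const : ∀ m c → ∑[ i < m ] c ≡ m * c
∑-const zero    c = refl
∑-const (suc m) c = cong (c +_) (∑-const m c)

∑-zero : ∀ {m} (f : Fin m → ℕ) → (∀ j → f j ≡ 0) → ∑[ j < m ] f j ≡ 0
∑-zero {zero}  f f≡0 = refl
∑-zero {suc m} f f≡0 = cong₂ _+_ (f≡0 zero) (∑-zero (f ∘ suc) (f≡0 ∘ suc))

∑-δ : ∀ {m} (f : Fin m → ℕ) i → (∀ j → j ≢ i → f j ≡ 0) → ∑[ j < m ] f j ≡ f i
∑-δ {suc m} f zero    f≡0 =
  trans (cong (f zero +_) (∑-zero (f ∘ suc) (λ j → f≡0 (suc j) λ ()))) (+-identityʳ (f zero))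
∑-δ {suc m} f (suc i) f≡0 =
  trans (cong (_+ ∑[ j < m ] f (suc j)) (f≡0 zero λ ()))
        (∑-δ (f ∘ suc) i (λ j j≢i → f≡0 (suc j) (j≢i ∘ Fin-suc-injective)))

closer≡∑ : ∀ G u v → closer G u v ≡ ∑[ w < n G ] ⟦ dist G w u < dist G w v ⟧
closer≡∑ G u v =
  trans (length-filter≡sum (λ w → dist G w u <? dist G w v) (allFin (n G))) (sum-map-allFin {n G} _)

-- The summand of mostar, which is a where-bound (hence unnameable) function in Defs.
edgeTerm : (G : Graph) → Fin (n G) → Fin (n G) → ℕ
edgeTerm G u v = if (toℕ u <ᵇ toℕ v) ∧ adj G u v then ∣ closer G u v - closer G v u ∣ else 0

mostar≡∑∑ : ∀ G → mostar G ≡ ∑[ u < n G ] ∑[ v < n G ] edgeTerm G u v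
mostar≡∑∑ G = begin
  mostar G                                          ≡⟨ sum-concatMap row (allFin (n G)) ⟩
  List.sum (map (List.sum ∘ row) (allFin (n G)))    ≡⟨ sum-map-allFin (List.sum ∘ row) ⟩
  ∑[ u < n G ] List.sum (row u)                      ≡⟨ sum-cong-≗ (λ u → sum-map-allFin (edgeTerm G u)) ⟩
  ∑[ u < n G ] ∑[ v < n G ] edgeTerm G u v           ∎
  where
  open ≡-Reasoning
  row : Fin (n G) → List ℕ
  row u = map (edgeTerm G u) (allFin (n G))

∣+-∣-shift : ∀ x y k → y ≤ x → ∣ x + k - y ∣ ≡ ∣ x - y ∣ + k
∣+-∣-shift x y k y≤x = begin
  ∣ x + k - y ∣   ≡⟨ m≤n⇒∣n-m∣≡n∸m (≤-trans y≤x (m≤m+n x k)) ⟩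
  x + k ∸ y       ≡⟨ +-∸-comm k y≤x ⟩
  x ∸ y + k       ≡⟨ cong (_+ k) (≡.sym (m≤n⇒∣n-m∣≡n∸m y≤x)) ⟩
  ∣ x - y ∣ + k   ∎
  where open ≡-Reasoning

∣-∣-affine-toward : ∀ {x y p q} m → p ≡ 1 → q ≡ 0 → y ≤ suc x →
  ∣ x + suc m * p - (y + suc m * q) ∣ ≡ ∣ x + 1 * p - (y + 1 * q) ∣ + m * ∣ p - q ∣
∣-∣-affine-toward {x} {y} m refl refl y≤1+x = begin
  ∣ x + suc m * 1 - (y + suc m * 0) ∣   ≡⟨ cong₂ ∣_-_∣ (regroupˡ x m) (regroupʳ y m) ⟩
  ∣ (x + 1) + m - (y + 0) ∣             ≡⟨ ∣+-∣-shift (x + 1) (y + 0) m y+0≤x+1 ⟩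
  ∣ x + 1 - (y + 0) ∣ + m               ≡⟨ cong (∣ x + 1 - (y + 0) ∣ +_) (≡.sym (*-identityʳ m)) ⟩
  ∣ x + 1 - (y + 0) ∣ + m * 1           ∎
  where
  open ≡-Reasoning
  regroupˡ : ∀ x m → x + (1 + m) * 1 ≡ (x + 1) + m
  regroupˡ = solve-∀
  regroupʳ : ∀ y m → y + (1 + m) * 0 ≡ y + 0
  regroupʳ = solve-∀
  y+0≤x+1 : y + 0 ≤ x + 1
  y+0≤x+1 = subst₂ _≤_ (≡.sym (+-identityʳ y)) (+-comm 1 x) y≤1+x

∣-∣-affine-level : ∀ {x y p q} m → p ≡ 0 → q ≡ 0 →
  ∣ x + suc m * p - (y + suc m * q) ∣ ≡ ∣ x + 1 * p - (y + 1 * q) ∣ + m * ∣ p - q ∣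
∣-∣-affine-level {x} {y} m refl refl rewrite *-zeroʳ m | +-identityʳ ∣ x + 0 - (y + 0) ∣ = refl

if-cong-true : ∀ {b} {x y : ℕ} → (b ≡ true → x ≡ y) → (if b then x else 0) ≡ (if b then y else 0)
if-cong-true {true}  x≡y = x≡y refl
if-cong-true {false} _   = refl

if-0 : ∀ b → (if b then 0 else 0) ≡ 0
if-0 true  = refl
if-0 false = refl

if-affine : ∀ b {x y z} m → (b ≡ true → x ≡ y + m * z) →
  (if b then x else 0) ≡ (if b then y else 0) + m * (if b then z else 0)
if-affine true  m x≡ = x≡ refl
if-affine false m _  = ≡.sym (*-zeroʳ m)

∧-trueʳ : ∀ {a b} → a ∧ b ≡ true → b ≡ true
∧-trueʳ {true} b≡true = b≡true

-- Distance functions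

record IsDistance {V : Set} (A : V → V → Bool) (D : V → V → ℕ) : Set where
  field
    diagonal    : ∀ u → D u u ≡ 0
    positive    : ∀ u v → D u v ≡ 0 → u ≡ v
    edge-≤      : ∀ u v w → A v w ≡ true → D u w ≤ suc (D u v)
    predecessor : ∀ u v → u ≡ v ⊎ ∃[ w ] suc (D u w) ≡ D u v × A w v ≡ true

isDistance? : ∀ {n} (A : Fin n → Fin n → Bool) (D : Fin n → Fin n → ℕ) → Dec (IsDistance A D)
isDistance? A D =
  map′ (λ (d , p , e , q) → record { diagonal = d ; positive = p ; edge-≤ = e ; predecessor = q })
       (λ isDist → let open IsDistance isDist in diagonal , positive , edge-≤ , predecessor)
    ( all? (λ u → D u u ≟ℕ 0)
    ×-dec all? (λ u → all? λ v → (D u v ≟ℕ 0) →-dec (u ≟ v))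
    ×-dec all? (λ u → all? λ v → all? λ w → (A v w ≟ᵇ true) →-dec (D u w ≤? suc (D u v)))
    ×-dec all? (λ u → all? λ v → (u ≟ v) ⊎-dec any? λ w → (suc (D u w) ≟ℕ D u v) ×-dec (A w v ≟ᵇ true)))

IsDistance-↔ : ∀ {V W : Set} {A : V → V → Bool} {B : W → W → Bool} {D : V → V → ℕ} (e : W ↔ V) →
  (∀ x y → B x y ≡ A (Inverse.to e x) (Inverse.to e y)) → IsDistance A D → IsDistance B (D on Inverse.to e)
IsDistance-↔ {A = A} {B} {D} e B≡A isDist = record
  { diagonal    = λ u → diagonal (to u)
  ; positive    = λ u v D≡0 → to-injective (positive (to u) (to v) D≡0)
  ; edge-≤      = λ u v w vw → edge-≤ (to u) (to v) (to w) (trans (≡.sym (B≡A v w)) vw)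
  ; predecessor = λ u v → transport u v (predecessor (to u) (to v))
  }
  where
  open IsDistance isDist
  open Inverse e
  to-injective : ∀ {x y} → to x ≡ to y → x ≡ y
  to-injective {x} {y} eq = trans (≡.sym (strictlyInverseʳ x)) (trans (cong from eq) (strictlyInverseʳ y))
  transport : ∀ u v → to u ≡ to v ⊎ ∃[ w ] suc (D (to u) w) ≡ D (to u) (to v) × A w (to v) ≡ true →
    u ≡ v ⊎ ∃[ w ] suc (D (to u) (to w)) ≡ D (to u) (to v) × B w v ≡ true
  transport u v (inj₁ eq)            = inj₁ (to-injective eq)
  transport u v (inj₂ (w , D≡ , wv)) = inj₂
    ( from w
    , subst (λ x → suc (D (to u) x) ≡ D (to u) (to v)) (≡.sym (strictlyInverseˡ w)) D≡
    , trans (B≡A (from w) v) (subst (λ x → A x (to v) ≡ true) (≡.sym (strictlyInverseˡ w)) wv))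

module _ (G : Graph) {D : Fin (n G) → Fin (n G) → ℕ} (isDist : IsDistance (adj G) D) where
  open IsDistance isDist

  reach⇔ : ∀ k u v → T (reach G k u v) ⇔ D u v ≤ k
  reach⇔ zero    u v = mk⇔
    (λ u≡v → ≤-reflexive (trans (cong (D u) (≡.sym (toWitness u≡v))) (diagonal u)))
    (λ D≤0 → fromWitness (positive u v (n≤0⇒n≡0 D≤0)))
  reach⇔ (suc k) u v = mk⇔ sound complete
    where
    step : Fin (n G) → Bool
    step w = reach G k u w ∧ adj G w v
    sound : T (reach G (suc k) u v) → D u v ≤ suc k
    sound r with Equivalence.to T-∨ r
    ... | inj₁ r′ = m≤n⇒m≤1+n (Equivalence.to (reach⇔ k u v) r′)
    ... | inj₂ r′ with satisfied (any⁻ step (allFin (n G)) r′)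
    ...   | w , r″ with Equivalence.to T-∧ r″
    ...     | uw , wv = ≤-trans (edge-≤ u w v (Equivalence.to T-≡ wv)) (s≤s (Equivalence.to (reach⇔ k u w) uw))
    complete : D u v ≤ suc k → T (reach G (suc k) u v)
    complete D≤ with m≤n⇒m<n∨m≡n D≤ | predecessor u v
    ... | inj₁ (s≤s D≤k) | _         = Equivalence.from T-∨ (inj₁ (Equivalence.from (reach⇔ k u v) D≤k))
    ... | inj₂ D≡        | inj₁ refl = contradiction (trans (≡.sym (diagonal u)) D≡) λ ()
    ... | inj₂ D≡        | inj₂ (w , D≡′ , wv) =
      Equivalence.from T-∨ (inj₂ (any⁺ step (lose (∈-allFin w) (Equivalence.from T-∧ (uw , Equivalence.from T-≡ wv)))))
      where
      uw : T (reach G k u w)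
      uw = Equivalence.from (reach⇔ k u w) (≤-reflexive (suc-injective (trans D≡′ D≡)))

  reach≡ : ∀ k u v → reach G k u v ≡ does (D u v ≤? k)
  reach≡ k u v =
    det (fromEquivalence (Equivalence.to (reach⇔ k u v)) (Equivalence.from (reach⇔ k u v))) (proof (D u v ≤? k))

  connected : 1 ≤ n G → Connected G
  connected 1≤n = 1≤n , λ u v → D u v , Equivalence.to T-≡ (Equivalence.from (reach⇔ (D u v) u v) ≤-refl)

-- The record pattern exposes the field n, so that 4 ≤ n G lets dist unfold its search four times.
dist≡ : ∀ G (D : Fin (n G) → Fin (n G) → ℕ) → 4 ≤ n G → IsDistance (adj G) D → (∀ u v → D u v ≤ 3) →
  ∀ u v → dist G u v ≡ D u v
dist≡ G@record { n = _ } D (s≤s (s≤s (s≤s (s≤s _)))) isDist D≤3 u v =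
  unroll (reach≡ G isDist 0 u v) (reach≡ G isDist 1 u v) (reach≡ G isDist 2 u v) (reach≡ G isDist 3 u v) (D≤3 u v)
  where
  unroll : ∀ {b₀ b₁ b₂ b₃ d x} → b₀ ≡ does (d ≤? 0) → b₁ ≡ does (d ≤? 1) → b₂ ≡ does (d ≤? 2) → b₃ ≡ does (d ≤? 3) →
    d ≤ 3 → (if b₀ then 0 else if b₁ then 1 else if b₂ then 2 else if b₃ then 3 else x) ≡ d
  unroll {d = 0} refl refl refl refl _ = refl
  unroll {d = 1} refl refl refl refl _ = refl
  unroll {d = 2} refl refl refl refl _ = refl
  unroll {d = 3} refl refl refl refl _ = refl
  unroll {d = suc (suc (suc (suc _)))} _ _ _ _ (s≤s (s≤s (s≤s ())))

does-≟-sym : ∀ {k} (s t : Fin k) → does (s ≟ t) ≡ does (t ≟ s)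
does-≟-sym s t with s ≟ t | t ≟ s
... | yes _   | yes _   = refl
... | no _    | no _    = refl
... | yes s≡t | no t≢s  = contradiction (≡.sym s≡t) t≢s
... | no s≢t  | yes t≡s = contradiction (≡.sym t≡s) s≢t

fromEdges : (k : ℕ) → List (ℕ × ℕ) → Graph
fromEdges k es = record
  { n     = k
  ; adj   = adjacent
  ; sym   = λ s t → cong₂ _∧_ (∨-comm (listed s t) (listed t s)) (cong not (does-≟-sym s t))
  ; irref = λ s → trans (cong (λ b → (listed s s ∨ listed s s) ∧ not b) (dec-true (s ≟ s) refl)) (∧-zeroʳ _)
  }
  where
  listed : Fin k → Fin k → Bool
  listed s t = any (λ (a , b) → (a ≡ᵇ toℕ s) ∧ (b ≡ᵇ toℕ t)) es
  adjacent : Fin k → Fin k → Bool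
  adjacent s t = (listed s t ∨ listed t s) ∧ not (does (s ≟ t))

listedVertices : ∀ {k} → List ℕ → Fin k → Bool
listedVertices xs s = any (_≡ᵇ toℕ s) xs

-- Joining a graph to a clique

MostarRealisable : ℕ → Set
MostarRealisable p = Σ Graph (λ G → Connected G × (mostar G ≡ p))

module CliqueJoin (H : Graph) (N : Fin (n H) → Bool) where

  Vertex : ℕ → Set
  Vertex m = Fin (n H) ⊎ Fin m

  joinAdj : ∀ {m} → Vertex m → Vertex m → Bool
  joinAdj (inj₁ s) (inj₁ t) = adj H s t
  joinAdj (inj₁ s) (inj₂ _) = N s
  joinAdj (inj₂ _) (inj₁ t) = N t
  joinAdj (inj₂ i) (inj₂ j) = not (does (i ≟ j))

  joinAdj-sym : ∀ {m} (x y : Vertex m) → joinAdj x y ≡ joinAdj y x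
  joinAdj-sym (inj₁ s) (inj₁ t) = sym H s t
  joinAdj-sym (inj₁ s) (inj₂ _) = refl
  joinAdj-sym (inj₂ _) (inj₁ t) = refl
  joinAdj-sym (inj₂ i) (inj₂ j) = cong not (does-≟-sym i j)

  joinAdj-irrefl : ∀ {m} (x : Vertex m) → joinAdj x x ≡ false
  joinAdj-irrefl (inj₁ s) = irref H s
  joinAdj-irrefl (inj₂ i) = cong not (dec-true (i ≟ i) refl)

  joinK : ℕ → Graph
  joinK m = record
    { n     = n H + m
    ; adj   = joinAdj on splitAt (n H)
    ; sym   = λ u v → joinAdj-sym (splitAt (n H) u) (splitAt (n H) v)
    ; irref = λ u → joinAdj-irrefl (splitAt (n H) u)
    }

  cone : Graph
  cone = joinK 1

  apex : Vertex 1
  apex = inj₂ zero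

  cliqueDist : ∀ {m} → Fin m → Fin m → ℕ
  cliqueDist i j = if does (i ≟ j) then 0 else 1

  cliqueDist-diagonal : ∀ {m} (i : Fin m) → cliqueDist i i ≡ 0
  cliqueDist-diagonal i = cong (λ b → if b then 0 else 1) (dec-true (i ≟ i) refl)

  cliqueDist-≢ : ∀ {m} {i j : Fin m} → i ≢ j → cliqueDist i j ≡ 1
  cliqueDist-≢ {i = i} {j} i≢j = cong (λ b → if b then 0 else 1) (dec-false (i ≟ j) i≢j)

  cliqueDist≤1 : ∀ {m} (i j : Fin m) → cliqueDist i j ≤ 1
  cliqueDist≤1 i j with does (i ≟ j)
  ... | true  = z≤n
  ... | false = ≤-refl

  blowUp : ∀ {m} → (Vertex 1 → Vertex 1 → ℕ) → Vertex m → Vertex m → ℕ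
  blowUp d (inj₁ s) (inj₁ t) = d (inj₁ s) (inj₁ t)
  blowUp d (inj₁ s) (inj₂ _) = d (inj₁ s) apex
  blowUp d (inj₂ _) (inj₁ t) = d apex (inj₁ t)
  blowUp d (inj₂ i) (inj₂ j) = cliqueDist i j

  blowUp-isDistance : ∀ {d m} → IsDistance joinAdj d → IsDistance (joinAdj {suc m}) (blowUp d)
  blowUp-isDistance {d} isDist = record
    { diagonal    = λ { (inj₁ s) → diagonal (inj₁ s) ; (inj₂ i) → cliqueDist-diagonal i }
    ; positive    = positive′
    ; edge-≤      = edge-≤′
    ; predecessor = predecessor′
    }
    where
    open IsDistance isDist
    positive′ : ∀ x y → blowUp d x y ≡ 0 → x ≡ y
    positive′ (inj₁ s) (inj₁ t) d≡0 = cong inj₁ (inj₁-injective (positive (inj₁ s) (inj₁ t) d≡0))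
    positive′ (inj₁ s) (inj₂ _) d≡0 with () ← positive (inj₁ s) apex d≡0
    positive′ (inj₂ _) (inj₁ t) d≡0 with () ← positive apex (inj₁ t) d≡0
    positive′ (inj₂ i) (inj₂ j) d≡0 with i ≟ j
    ... | yes i≡j = cong inj₂ i≡j
    ... | no _ with () ← d≡0
    edge-≤′ : ∀ x y z → joinAdj y z ≡ true → blowUp d x z ≤ suc (blowUp d x y)
    edge-≤′ (inj₁ s) (inj₁ p) (inj₁ t) pt = edge-≤ (inj₁ s) (inj₁ p) (inj₁ t) pt
    edge-≤′ (inj₁ s) (inj₁ p) (inj₂ _) pt = edge-≤ (inj₁ s) (inj₁ p) apex pt
    edge-≤′ (inj₁ s) (inj₂ _) (inj₁ t) pt = edge-≤ (inj₁ s) apex (inj₁ t) pt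
    edge-≤′ (inj₁ s) (inj₂ _) (inj₂ _) _  = n≤1+n _
    edge-≤′ (inj₂ _) (inj₁ p) (inj₁ t) pt = edge-≤ apex (inj₁ p) (inj₁ t) pt
    edge-≤′ (inj₂ i) (inj₁ _) (inj₂ j) _  = ≤-trans (cliqueDist≤1 i j) (s≤s z≤n)
    edge-≤′ (inj₂ _) (inj₂ _) (inj₁ t) pt =
      ≤-trans (subst (λ k → d apex (inj₁ t) ≤ suc k) (diagonal apex) (edge-≤ apex apex (inj₁ t) pt)) (s≤s z≤n)
    edge-≤′ (inj₂ i) (inj₂ _) (inj₂ j) _  = ≤-trans (cliqueDist≤1 i j) (s≤s z≤n)
    predecessor′ : ∀ x y → x ≡ y ⊎ ∃[ z ] suc (blowUp d x z) ≡ blowUp d x y × joinAdj z y ≡ true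
    predecessor′ (inj₁ s) (inj₁ t) with predecessor (inj₁ s) (inj₁ t)
    ... | inj₁ s≡t                   = inj₁ (cong inj₁ (inj₁-injective s≡t))
    ... | inj₂ (inj₁ w , d≡ , wt)    = inj₂ (inj₁ w , d≡ , wt)
    ... | inj₂ (inj₂ zero , d≡ , wt) = inj₂ (inj₂ zero , d≡ , wt)
    predecessor′ (inj₁ s) (inj₂ _) with predecessor (inj₁ s) apex
    ... | inj₁ ()
    ... | inj₂ (inj₁ w , d≡ , wt)    = inj₂ (inj₁ w , d≡ , wt)
    ... | inj₂ (inj₂ zero , _ , ())
    predecessor′ (inj₂ i) (inj₁ t) with predecessor apex (inj₁ t)
    ... | inj₁ ()
    ... | inj₂ (inj₁ w , d≡ , wt)    = inj₂ (inj₁ w , d≡ , wt)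
    ... | inj₂ (inj₂ zero , d≡ , wt) =
      inj₂ (inj₂ i , trans (cong suc (trans (cliqueDist-diagonal i) (≡.sym (diagonal apex)))) d≡ , wt)
    predecessor′ (inj₂ i) (inj₂ j) with i ≟ j
    ... | yes i≡j = inj₁ (cong inj₂ i≡j)
    ... | no i≢j  = inj₂ (inj₂ i , cong suc (cliqueDist-diagonal i) , cong not (dec-false (i ≟ j) i≢j))

  coneMetric : Vertex 1 → Vertex 1 → ℕ
  coneMetric = dist cone on join (n H) 1

  apexDist : Fin (n H) → ℕ
  apexDist s = coneMetric apex (inj₁ s)

  closerInH : Vertex 1 → Vertex 1 → ℕ
  closerInH x y = ∑[ s < n H ] ⟦ coneMetric (inj₁ s) x < coneMetric (inj₁ s) y ⟧

  -- For an edge st of H, closerInJoin m s t is n_s in joinK m (see closerᵛ-HH below).  Along an edge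
  -- leading away from the apex n_s gains m, and ApexSideHeavier keeps n_s - n_t from changing sign.
  closerInJoin : ℕ → Fin (n H) → Fin (n H) → ℕ
  closerInJoin m s t = closerInH (inj₁ s) (inj₁ t) + m * ⟦ apexDist s < apexDist t ⟧

  ApexSideHeavier : Set
  ApexSideHeavier = ∀ s t → adj H s t ≡ true → apexDist s < apexDist t →
    closerInH (inj₁ t) (inj₁ s) ≤ suc (closerInH (inj₁ s) (inj₁ t))

  orderedEdge : Fin (n H) → Fin (n H) → Bool
  orderedEdge s t = (toℕ s <ᵇ toℕ t) ∧ adj H s t

  hEdgeTerm : ℕ → Fin (n H) → Fin (n H) → ℕ
  hEdgeTerm m s t = if orderedEdge s t then ∣ closerInJoin m s t - closerInJoin m t s ∣ else 0

  spokeTerm : Fin (n H) → ℕ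
  spokeTerm s = if N s then ∣ closerInH (inj₁ s) apex - (closerInH apex (inj₁ s) + 1) ∣ else 0

  levelJump : Fin (n H) → Fin (n H) → ℕ
  levelJump s t = if orderedEdge s t then ∣ ⟦ apexDist s < apexDist t ⟧ - ⟦ apexDist t < apexDist s ⟧ ∣ else 0

  slope : ℕ
  slope = ∑[ s < n H ] (∑[ t < n H ] levelJump s t + spokeTerm s)

  -- coneDiam and 3≤n are what dist≡ needs to evaluate dist on every joinK (suc m).
  record Certificate : Set where
    field
      coneDist : IsDistance (adj cone) (dist cone)
      coneDiam : ∀ u v → dist cone u v ≤ 3
      3≤n      : 3 ≤ n H
      heavier  : ApexSideHeavier

  certificate? : Dec Certificate
  certificate? =
    map′ (λ (c , d , l , h) → record { coneDist = c ; coneDiam = d ; 3≤n = l ; heavier = h })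
         (λ cert → let open Certificate cert in coneDist , coneDiam , 3≤n , heavier)
      ( isDistance? (adj cone) (dist cone)
      ×-dec all? (λ u → all? λ v → dist cone u v ≤? 3)
      ×-dec 3 ≤? n H
      ×-dec all? (λ s → all? λ t → (adj H s t ≟ᵇ true) →-dec (apexDist s <? apexDist t)
                   →-dec (closerInH (inj₁ t) (inj₁ s) ≤? suc (closerInH (inj₁ s) (inj₁ t)))))

  module Growth (cert : Certificate) where
    open Certificate cert

    coneMetric-isDistance : IsDistance joinAdj coneMetric
    coneMetric-isDistance = IsDistance-↔ (↔-sym +↔⊎)
      (λ x y → cong₂ joinAdj (≡.sym (splitAt-join (n H) 1 x)) (≡.sym (splitAt-join (n H) 1 y))) coneDist

    open IsDistance coneMetric-isDistance using (diagonal; positive; edge-≤)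

    joinMetric : ∀ {m} → Vertex m → Vertex m → ℕ
    joinMetric = blowUp coneMetric

    joinMetric≤3 : ∀ {m} (x y : Vertex m) → joinMetric x y ≤ 3
    joinMetric≤3 (inj₁ s) (inj₁ t) = coneDiam _ _
    joinMetric≤3 (inj₁ s) (inj₂ _) = coneDiam _ _
    joinMetric≤3 (inj₂ _) (inj₁ t) = coneDiam _ _
    joinMetric≤3 (inj₂ i) (inj₂ j) = ≤-trans (cliqueDist≤1 i j) (s≤s z≤n)

    joinK-isDistance : ∀ m → IsDistance (adj (joinK (suc m))) (joinMetric on splitAt (n H))
    joinK-isDistance m = IsDistance-↔ +↔⊎ (λ _ _ → refl) (blowUp-isDistance coneMetric-isDistance)

    dist-joinK : ∀ m u v → dist (joinK (suc m)) u v ≡ joinMetric (splitAt (n H) u) (splitAt (n H) v)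
    dist-joinK m = dist≡ (joinK (suc m)) _ (+-mono-≤ 3≤n (s≤s z≤n)) (joinK-isDistance m)
      (λ u v → joinMetric≤3 (splitAt (n H) u) (splitAt (n H) v))

    apexDist≥1 : ∀ s → 1 ≤ apexDist s
    apexDist≥1 s with apexDist s in eq
    ... | zero  with () ← positive apex (inj₁ s) eq
    ... | suc _ = s≤s z≤n

    apexDist-N : ∀ {s} → N s ≡ true → apexDist s ≡ 1
    apexDist-N {s} Ns = ≤-antisym
      (subst (λ k → apexDist s ≤ suc k) (diagonal apex) (edge-≤ apex apex (inj₁ s) Ns))
      (apexDist≥1 s)

    closerᵛ : ∀ m → Vertex m → Vertex m → ℕ
    closerᵛ m x y = ∑[ s < n H ] ⟦ joinMetric (inj₁ s) x < joinMetric (inj₁ s) y ⟧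
                  + ∑[ i < m ] ⟦ joinMetric (inj₂ i) x < joinMetric (inj₂ i) y ⟧

    closer-joinK : ∀ m u v → closer (joinK (suc m)) u v ≡ closerᵛ (suc m) (splitAt (n H) u) (splitAt (n H) v)
    closer-joinK m u v = begin
      closer (joinK (suc m)) u v
        ≡⟨ closer≡∑ (joinK (suc m)) u v ⟩
      ∑[ w < n H + suc m ] ⟦ dist (joinK (suc m)) w u < dist (joinK (suc m)) w v ⟧
        ≡⟨ sum-cong-≗ (λ w → cong₂ ⟦_<_⟧ (dist-joinK m w u) (dist-joinK m w v)) ⟩
      ∑[ w < n H + suc m ] count (splitAt (n H) w)
        ≡⟨ ∑-↑ (n H) (suc m) (count ∘ splitAt (n H)) ⟩
      ∑[ s < n H ] count (splitAt (n H) (s ↑ˡ suc m)) + ∑[ i < suc m ] count (splitAt (n H) (n H ↑ʳ i))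
        ≡⟨ cong₂ _+_ (sum-cong-≗ (λ s → cong count (splitAt-↑ˡ (n H) s (suc m))))
                     (sum-cong-≗ (λ i → cong count (splitAt-↑ʳ (n H) (suc m) i))) ⟩
      closerᵛ (suc m) (splitAt (n H) u) (splitAt (n H) v)
        ∎
      where
      open ≡-Reasoning
      count : Vertex (suc m) → ℕ
      count z = ⟦ joinMetric z (splitAt (n H) u) < joinMetric z (splitAt (n H) v) ⟧

    closerᵛ-HH : ∀ m s t → closerᵛ m (inj₁ s) (inj₁ t) ≡ closerInJoin m s t
    closerᵛ-HH m s t = cong (closerInH (inj₁ s) (inj₁ t) +_) (∑-const m _)

    closerᵛ-HK : ∀ m s j → closerᵛ m (inj₁ s) (inj₂ j) ≡ closerInH (inj₁ s) apex
    closerᵛ-HK m s j = trans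
      (cong (closerInH (inj₁ s) apex +_) (∑-zero _ λ i → ⟦<⟧-no (≤-trans (cliqueDist≤1 i j) (apexDist≥1 s))))
      (+-identityʳ _)

    closerᵛ-KH : ∀ m i {t} → N t ≡ true → closerᵛ (suc m) (inj₂ i) (inj₁ t) ≡ closerInH apex (inj₁ t) + 1
    closerᵛ-KH m i {t} Nt = cong (closerInH apex (inj₁ t) +_) (trans
      (∑-δ _ i λ l l≢i → cong₂ ⟦_<_⟧ (cliqueDist-≢ l≢i) (apexDist-N Nt))
      (cong₂ ⟦_<_⟧ (cliqueDist-diagonal i) (apexDist-N Nt)))

    closerᵛ-KK : ∀ m {i j} → i ≢ j → closerᵛ (suc m) (inj₂ i) (inj₂ j) ≡ 1
    closerᵛ-KK m {i} {j} i≢j = cong₂ _+_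
      (∑-zero _ λ s → ⟦<⟧-no {coneMetric (inj₁ s) apex} ≤-refl)
      (trans (∑-δ _ i λ l l≢i → trans (cong ⟦_< cliqueDist l j ⟧ (cliqueDist-≢ {i = l} l≢i)) (⟦<⟧-no (cliqueDist≤1 l j)))
             (cong₂ ⟦_<_⟧ (cliqueDist-diagonal i) (cliqueDist-≢ i≢j)))

    edgeTerm-join : ∀ m x y → let ι = join (n H) (suc m) in
      edgeTerm (joinK (suc m)) (ι x) (ι y)
        ≡ (if (toℕ (ι x) <ᵇ toℕ (ι y)) ∧ joinAdj x y then ∣ closerᵛ (suc m) x y - closerᵛ (suc m) y x ∣ else 0)
    edgeTerm-join m x y = cong₂ (λ b c → if (toℕ (ι x) <ᵇ toℕ (ι y)) ∧ b then c else 0)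
      (cong₂ joinAdj (splitAt-join (n H) (suc m) x) (splitAt-join (n H) (suc m) y))
      (cong₂ ∣_-_∣ (closer-ι x y) (closer-ι y x))
      where
      ι = join (n H) (suc m)
      closer-ι : ∀ x y → closer (joinK (suc m)) (ι x) (ι y) ≡ closerᵛ (suc m) x y
      closer-ι x y = trans (closer-joinK m (ι x) (ι y))
        (cong₂ (closerᵛ (suc m)) (splitAt-join (n H) (suc m) x) (splitAt-join (n H) (suc m) y))

    edgeTerm-HH : ∀ m s t → edgeTerm (joinK (suc m)) (s ↑ˡ suc m) (t ↑ˡ suc m) ≡ hEdgeTerm (suc m) s t
    edgeTerm-HH m s t = trans (edgeTerm-join m (inj₁ s) (inj₁ t))
      (cong₂ (λ b c → if b ∧ adj H s t then c else 0) (cong₂ _<ᵇ_ (toℕ-↑ˡ s (suc m)) (toℕ-↑ˡ t (suc m)))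
        (cong₂ ∣_-_∣ (closerᵛ-HH (suc m) s t) (closerᵛ-HH (suc m) t s)))

    edgeTerm-HK : ∀ m s j → edgeTerm (joinK (suc m)) (s ↑ˡ suc m) (n H ↑ʳ j) ≡ spokeTerm s
    edgeTerm-HK m s j = trans (edgeTerm-join m (inj₁ s) (inj₂ j))
      (trans (cong (λ b → if b ∧ N s then ∣ closerᵛ (suc m) sᵛ jᵛ - closerᵛ (suc m) jᵛ sᵛ ∣ else 0) s<K+j)
             (if-cong-true λ Ns → cong₂ ∣_-_∣ (closerᵛ-HK (suc m) s j) (closerᵛ-KH m j Ns)))
      where
      sᵛ jᵛ : Vertex (suc m)
      sᵛ = inj₁ s
      jᵛ = inj₂ j
      s<K+j : (toℕ (s ↑ˡ suc m) <ᵇ toℕ (n H ↑ʳ j)) ≡ true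
      s<K+j = trans (cong₂ _<ᵇ_ (toℕ-↑ˡ s (suc m)) (toℕ-↑ʳ (n H) j))
                    (dec-true (toℕ s <? n H + toℕ j) (<-≤-trans (toℕ<n s) (m≤m+n (n H) (toℕ j))))

    edgeTerm-KH : ∀ m i t → edgeTerm (joinK (suc m)) (n H ↑ʳ i) (t ↑ˡ suc m) ≡ 0
    edgeTerm-KH m i t = trans (edgeTerm-join m (inj₂ i) (inj₁ t))
      (cong (λ b → if b ∧ N t then ∣ closerᵛ (suc m) iᵛ tᵛ - closerᵛ (suc m) tᵛ iᵛ ∣ else 0) K+i≮t)
      where
      iᵛ tᵛ : Vertex (suc m)
      iᵛ = inj₂ i
      tᵛ = inj₁ t
      K+i≮t : (toℕ (n H ↑ʳ i) <ᵇ toℕ (t ↑ˡ suc m)) ≡ false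
      K+i≮t = trans (cong₂ _<ᵇ_ (toℕ-↑ʳ (n H) i) (toℕ-↑ˡ t (suc m)))
                    (dec-false (n H + toℕ i <? toℕ t) (≤⇒≯ (≤-trans (<⇒≤ (toℕ<n t)) (m≤m+n (n H) (toℕ i)))))

    edgeTerm-KK : ∀ m i j → edgeTerm (joinK (suc m)) (n H ↑ʳ i) (n H ↑ʳ j) ≡ 0
    edgeTerm-KK m i j = trans (edgeTerm-join m (inj₂ i) (inj₂ j))
      (trans (cong (λ c → if guard then c else 0) balanced) (if-0 guard))
      where
      guard : Bool
      guard = (toℕ (n H ↑ʳ i) <ᵇ toℕ (n H ↑ʳ j)) ∧ joinAdj (inj₂ i) (inj₂ j)
      balanced : ∣ closerᵛ (suc m) (inj₂ i) (inj₂ j) - closerᵛ (suc m) (inj₂ j) (inj₂ i) ∣ ≡ 0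
      balanced with i ≟ j
      ... | yes refl = ∣n-n∣≡0 (closerᵛ (suc m) (inj₂ i) (inj₂ i))
      ... | no i≢j   = cong₂ ∣_-_∣ (closerᵛ-KK m i≢j) (closerᵛ-KK m (i≢j ∘ ≡.sym))

    mostar-joinK≡∑ : ∀ m →
      mostar (joinK (suc m)) ≡ ∑[ s < n H ] (∑[ t < n H ] hEdgeTerm (suc m) s t + suc m * spokeTerm s)
    mostar-joinK≡∑ m = begin
      mostar (joinK (suc m))
        ≡⟨ mostar≡∑∑ (joinK (suc m)) ⟩
      ∑[ u < n H + suc m ] row u
        ≡⟨ ∑-↑ (n H) (suc m) row ⟩
      ∑[ s < n H ] row (s ↑ˡ suc m) + ∑[ i < suc m ] row (n H ↑ʳ i)
        ≡⟨ cong₂ _+_ (sum-cong-≗ rowH) (∑-zero _ rowK) ⟩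
      ∑[ s < n H ] (∑[ t < n H ] hEdgeTerm (suc m) s t + suc m * spokeTerm s) + 0
        ≡⟨ +-identityʳ _ ⟩
      ∑[ s < n H ] (∑[ t < n H ] hEdgeTerm (suc m) s t + suc m * spokeTerm s)
        ∎
      where
      open ≡-Reasoning
      row : Fin (n H + suc m) → ℕ
      row u = ∑[ v < n H + suc m ] edgeTerm (joinK (suc m)) u v
      rowH : ∀ s → row (s ↑ˡ suc m) ≡ ∑[ t < n H ] hEdgeTerm (suc m) s t + suc m * spokeTerm s
      rowH s = trans (∑-↑ (n H) (suc m) _)
        (cong₂ _+_ (sum-cong-≗ (edgeTerm-HH m s)) (trans (sum-cong-≗ (edgeTerm-HK m s)) (∑-const (suc m) _)))
      rowK : ∀ i → row (n H ↑ʳ i) ≡ 0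
      rowK i = trans (∑-↑ (n H) (suc m) _) (cong₂ _+_ (∑-zero _ (edgeTerm-KH m i)) (∑-zero _ (edgeTerm-KK m i)))

    closerGap-suc : ∀ m s t → adj H s t ≡ true →
      ∣ closerInJoin (suc m) s t - closerInJoin (suc m) t s ∣
        ≡ ∣ closerInJoin 1 s t - closerInJoin 1 t s ∣ + m * ∣ ⟦ apexDist s < apexDist t ⟧ - ⟦ apexDist t < apexDist s ⟧ ∣
    closerGap-suc m s t st with <-cmp (apexDist s) (apexDist t)
    ... | tri< s<t _ _ = ∣-∣-affine-toward m (⟦<⟧-yes s<t) (⟦<⟧-no (<⇒≤ s<t)) (heavier s t st s<t)
    ... | tri≈ _ s≡t _ = ∣-∣-affine-level {closerInH (inj₁ s) (inj₁ t)} {closerInH (inj₁ t) (inj₁ s)} m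
                           (⟦<⟧-no (≤-reflexive (≡.sym s≡t))) (⟦<⟧-no (≤-reflexive s≡t))
    ... | tri> _ _ t<s = begin
      ∣ closerInJoin (suc m) s t - closerInJoin (suc m) t s ∣
        ≡⟨ ∣-∣-comm (closerInJoin (suc m) s t) _ ⟩
      ∣ closerInJoin (suc m) t s - closerInJoin (suc m) s t ∣
        ≡⟨ ∣-∣-affine-toward m (⟦<⟧-yes t<s) (⟦<⟧-no (<⇒≤ t<s)) (heavier t s (trans (sym H t s) st) t<s) ⟩
      ∣ closerInJoin 1 t s - closerInJoin 1 s t ∣ + m * ∣ ⟦ apexDist t < apexDist s ⟧ - ⟦ apexDist s < apexDist t ⟧ ∣
        ≡⟨ cong₂ (λ a b → a + m * b) (∣-∣-comm (closerInJoin 1 t s) _) (∣-∣-comm ⟦ apexDist t < apexDist s ⟧ _) ⟩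
      ∣ closerInJoin 1 s t - closerInJoin 1 t s ∣ + m * ∣ ⟦ apexDist s < apexDist t ⟧ - ⟦ apexDist t < apexDist s ⟧ ∣
        ∎
      where open ≡-Reasoning

    hEdgeTerm-suc : ∀ m s t → hEdgeTerm (suc m) s t ≡ hEdgeTerm 1 s t + m * levelJump s t
    hEdgeTerm-suc m s t = if-affine (orderedEdge s t) m (λ st → closerGap-suc m s t (∧-trueʳ st))

    mostar-joinK : ∀ m → mostar (joinK (suc m)) ≡ mostar cone + m * slope
    mostar-joinK m = begin
      mostar (joinK (suc m))
        ≡⟨ mostar-joinK≡∑ m ⟩
      ∑[ s < n H ] (∑[ t < n H ] hEdgeTerm (suc m) s t + suc m * spokeTerm s)
        ≡⟨ sum-cong-≗ rowGrowth ⟩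
      ∑[ s < n H ] (row₁ s + m * rowSlope s)
        ≡⟨ ∑-distrib-+ row₁ (λ s → m * rowSlope s) ⟩
      ∑[ s < n H ] row₁ s + ∑[ s < n H ] (m * rowSlope s)
        ≡⟨ cong₂ _+_ (≡.sym (mostar-joinK≡∑ 0)) (≡.sym (*-distribˡ-sum m rowSlope)) ⟩
      mostar cone + m * slope
        ∎
      where
      open ≡-Reasoning
      row₁ rowSlope : Fin (n H) → ℕ
      row₁ s = ∑[ t < n H ] hEdgeTerm 1 s t + 1 * spokeTerm s
      rowSlope s = ∑[ t < n H ] levelJump s t + spokeTerm s
      regroup : ∀ a b c m → (a + m * b) + (1 + m) * c ≡ (a + 1 * c) + m * (b + c)
      regroup = solve-∀
      rowGrowth : ∀ s → ∑[ t < n H ] hEdgeTerm (suc m) s t + suc m * spokeTerm s ≡ row₁ s + m * rowSlope s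
      rowGrowth s = begin
        ∑[ t < n H ] hEdgeTerm (suc m) s t + suc m * spokeTerm s
          ≡⟨ cong (_+ suc m * spokeTerm s) (sum-cong-≗ (hEdgeTerm-suc m s)) ⟩
        ∑[ t < n H ] (hEdgeTerm 1 s t + m * levelJump s t) + suc m * spokeTerm s
          ≡⟨ cong (_+ suc m * spokeTerm s) (∑-distrib-+ (hEdgeTerm 1 s) (λ t → m * levelJump s t)) ⟩
        (∑[ t < n H ] hEdgeTerm 1 s t + ∑[ t < n H ] (m * levelJump s t)) + suc m * spokeTerm s
          ≡⟨ cong (λ x → ∑[ t < n H ] hEdgeTerm 1 s t + x + suc m * spokeTerm s) (≡.sym (*-distribˡ-sum m (levelJump s))) ⟩
        (∑[ t < n H ] hEdgeTerm 1 s t + m * ∑[ t < n H ] levelJump s t) + suc m * spokeTerm s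
          ≡⟨ regroup (∑[ t < n H ] hEdgeTerm 1 s t) (∑[ t < n H ] levelJump s t) (spokeTerm s) m ⟩
        row₁ s + m * rowSlope s
          ∎

    realises : ∀ m → MostarRealisable (mostar cone + m * slope)
    realises m = joinK (suc m)
               , connected (joinK (suc m)) (joinK-isDistance m) (+-mono-≤ (z≤n {n H}) (s≤s z≤n))
               , mostar-joinK m

-- The five families

module E = CliqueJoin (fromEdges 4 ((0 , 1) ∷ (1 , 2) ∷ (2 , 3) ∷ [])) (listedVertices (0 ∷ 3 ∷ []))
module A = CliqueJoin (fromEdges 5 ((0 , 1) ∷ (0 , 2) ∷ (0 , 3) ∷ (1 , 4) ∷ (2 , 4) ∷ [])) (listedVertices (0 ∷ 1 ∷ 2 ∷ []))
module B = CliqueJoin (fromEdges 5 ((0 , 1) ∷ (0 , 2) ∷ (0 , 3) ∷ (1 , 2) ∷ [])) (listedVertices (1 ∷ 3 ∷ 4 ∷ []))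
module C = CliqueJoin (fromEdges 5 ((0 , 1) ∷ (0 , 2) ∷ (0 , 3) ∷ (1 , 2) ∷ (1 , 3) ∷ [])) (listedVertices (0 ∷ 2 ∷ 4 ∷ []))
module F = CliqueJoin (fromEdges 4 ((0 , 1) ∷ (0 , 2) ∷ (1 , 3) ∷ [])) (listedVertices (0 ∷ 1 ∷ 3 ∷ []))

familyE : ∀ m → MostarRealisable (m * 2)
familyE = E.Growth.realises (from-yes E.certificate?)

familyA : ∀ m → MostarRealisable (11 + m * 4)
familyA = A.Growth.realises (from-yes A.certificate?)

familyB : ∀ m → MostarRealisable (9 + m * 8)
familyB = B.Growth.realises (from-yes B.certificate?)

familyC : ∀ m → MostarRealisable (13 + m * 8)
familyC = C.Growth.realises (from-yes C.certificate?)

coneF : MostarRealisable 7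
coneF = F.Growth.realises (from-yes F.certificate?) 0

data Attained : ℕ → Set where
  inE : ∀ m → Attained (m * 2)
  inA : ∀ m → Attained (11 + m * 4)
  inB : ∀ m → Attained (9 + m * 8)
  inC : ∀ m → Attained (13 + m * 8)
  inF : Attained 7

attained-+8 : ∀ {p} → Attained p → Attained (8 + p)
attained-+8 (inE m) = inE (4 + m)
attained-+8 (inA m) = inA (2 + m)
attained-+8 (inB m) = inB (1 + m)
attained-+8 (inC m) = inC (1 + m)
attained-+8 inF     = inA 1

attained-6+ : ∀ q → Attained (6 + q)
attained-6+ 0 = inE 3
attained-6+ 1 = inF
attained-6+ 2 = inE 4
attained-6+ 3 = inB 0
attained-6+ 4 = inE 5
attained-6+ 5 = inA 0
attained-6+ 6 = inE 6
attained-6+ 7 = inC 0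
attained-6+ (suc (suc (suc (suc (suc (suc (suc (suc q)))))))) = attained-+8 (attained-6+ q)

attained : ∀ p → p ≢ 1 → p ≢ 3 → p ≢ 5 → Attained p
attained 0 _   _   _   = inE 0
attained 1 p≢1 _   _   = contradiction refl p≢1
attained 2 _   _   _   = inE 1
attained 3 _   p≢3 _   = contradiction refl p≢3
attained 4 _   _   _   = inE 2
attained 5 _   _   p≢5 = contradiction refl p≢5
attained (suc (suc (suc (suc (suc (suc q)))))) _ _ _ = attained-6+ q

realise : ∀ {p} → Attained p → MostarRealisable p
realise (inE m) = familyE m
realise (inA m) = familyA m
realise (inB m) = familyB m
realise (inC m) = familyC m
realise inF     = coneF

mainTheorem4 : (p : ℕ) → ¬ (p ≡ 1) → ¬ (p ≡ 3) → ¬ (p ≡ 5) →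
    Σ Graph (λ G → Connected G × (mostar G ≡ p))
mainTheorem4 p p≢1 p≢3 p≢5 = realise (attained p p≢1 p≢3 p≢5)
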